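{- Let $V$ be a finite set, $c:\binom{V}{2}\to\mathbb{R}_+$, and $V_1,\dots,V_h$ a partition of $V$. Let $S'\subseteq V$. Then there is some $i$ such that $c(\delta(S'\setminus V_i))\ge(1-\frac2h)\,c(\delta S')$.
   Context: For $S\subseteq V$, $\delta S$ is the set of pairs $\{u,v\}\in\binom{V}{2}$ with exactly one element in $S$, and $c(F)=\sum_{e\in F}c_e$.
   Formalization: The edge costs $c$ are nonnegative rationals rather than reals. -}

module Defs where

open import Data.Bool using (Bool; true; false; _∧_; _xor_; not; if_then_else_)
open import Data.Nat using (ℕ)
open import Data.Fin using (Fin; _<?_)
open import Data.Fin.Properties using (_≟_)
open import Data.List using (List; foldr; map; allFin)
open import Data.Rational using (ℚ; 0ℚ; _+_)
open import Relation.Nullary.Decidable using (⌊_⌋)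

Subset : ℕ → Set
Subset n = Fin n → Bool

sumℚ : List ℚ → ℚ
sumℚ = foldr _+_ 0ℚ

_∖_ : ∀ {n} → Subset n → Subset n → Subset n
(S ∖ T) v = S v ∧ not (T v)

block : ∀ {n h} → (Fin n → Fin h) → Fin h → Subset n
block part i v = ⌊ part v ≟ i ⌋

-- c(δS): sum of c over unordered pairs {u,v} (encoded as u < v) with
-- exactly one endpoint in S. Values c u v with ¬ u < v are never used.
cutCost : ∀ {n} → (Fin n → Fin n → ℚ) → Subset n → ℚ
cutCost {n} c S =
  sumℚ (map (λ u → sumℚ (map (λ v →
    if ⌊ u <? v ⌋ ∧ (S u xor S v) then c u v else 0ℚ) (allFin n))) (allFin n))

{-# OPTIONS --safe #-}
-- An edge {u,v} cut by S′ is still cut by S′ ∖ V_i unless V_i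
-- contains u or v, which happens for at most two of the h blocks. Hence
-- summing over all blocks, h·c(δS′) ≤ Σ_i c(δ(S′ ∖ V_i)) + 2·c(δS′), so the
-- average of c(δ(S′ ∖ V_i)) is at least (1 − 2/h)·c(δS′), and some block
-- attains the average.
module Submission where

open import Algebra.Bundles using (CommutativeRing)
open import Data.Bool using (true; false; _∧_; _xor_; not; if_then_else_)
open import Data.Bool.Properties using (∧-identityʳ)
open import Data.Empty using (⊥-elim)
open import Data.Fin using (Fin; zero; suc; _<_; _<?_)
open import Data.Fin.Properties using (_≟_; any?)
open import Data.Integer using (+_)
import Data.Integer as ℤ
import Data.Integer.Properties as ℤ
open import Data.List using (map; allFin; tabulate)
open import Data.List.Properties using (map-tabulate)
open import Data.Nat using (ℕ; zero; suc; NonZero)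
import Data.Nat as ℕ
import Data.Nat.Properties as ℕ
open import Data.Product using (∃; _,_)
open import Data.Rational using (ℚ; 0ℚ; 1ℚ; _+_; _-_; -_; _*_; _/_; _≤_; toℚᵘ)
import Data.Rational as ℚ
import Data.Rational.Properties as ℚ
open import Data.Rational.Solver using (module +-*-Solver)
open import Data.Rational.Unnormalised using (mkℚᵘ)
import Data.Rational.Unnormalised as ℚᵘ
import Data.Rational.Unnormalised.Properties as ℚᵘ
open import Function using (id; _∘_)
open import Relation.Binary.PropositionalEquality
open import Relation.Nullary using (yes; no)
open import Relation.Nullary.Decidable using (⌊_⌋; ⌊⌋-map′)

open import Defs

open import Algebra.Properties.Semiring.Sum (CommutativeRing.semiring ℚ.+-*-commutativeRing)
  using (sum-syntax; sum-cong-≗; sum-replicate; sum-replicate-zero; ∑-distrib-+; ∑-comm)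
open import Algebra.Properties.Semiring.Mult (CommutativeRing.semiring ℚ.+-*-commutativeRing)
  using (_×_; ×-assoc-*)
open import Algebra.Properties.Group (CommutativeRing.+-group ℚ.+-*-commutativeRing)
  using (//-rightDividesʳ)

p≤p+q : ∀ {p q} → 0ℚ ≤ q → p ≤ p + q
p≤p+q {p} {q} 0≤q = subst (_≤ p + q) (ℚ.+-identityʳ p) (ℚ.+-monoʳ-≤ p 0≤q)

p≤q+p : ∀ {p q} → 0ℚ ≤ q → p ≤ q + p
p≤q+p {p} {q} 0≤q = subst (_≤ q + p) (ℚ.+-identityˡ p) (ℚ.+-monoˡ-≤ p 0≤q)

if-nonneg : ∀ b {x} → 0ℚ ≤ x → 0ℚ ≤ (if b then x else 0ℚ)
if-nonneg true  0≤x = 0≤x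
if-nonneg false _   = ℚ.≤-refl

x≤y+ifx+ifx : ∀ {x y} a b → 0ℚ ≤ x → 0ℚ ≤ y → (a ≡ false → b ≡ false → y ≡ x) →
  x ≤ y + ((if a then x else 0ℚ) + (if b then x else 0ℚ))
x≤y+ifx+ifx true  b     0≤x 0≤y _   = ℚ.≤-trans (p≤p+q (if-nonneg b 0≤x)) (p≤q+p 0≤y)
x≤y+ifx+ifx false true  _   0≤y _   = ℚ.≤-trans (p≤q+p ℚ.≤-refl) (p≤q+p 0≤y)
x≤y+ifx+ifx false false _   _   y≡x = subst (_≤ _) (y≡x refl refl) (p≤p+q ℚ.≤-refl)

+-cancelʳ-≤ : ∀ r {p q} → p + r ≤ q + r → p ≤ q
+-cancelʳ-≤ r {p} {q} =
  subst₂ _≤_ (//-rightDividesʳ r p) (//-rightDividesʳ r q) ∘ ℚ.+-monoˡ-≤ (- r)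

/1-suc : ∀ n → + suc n / 1 ≡ 1ℚ + + n / 1
/1-suc n = ℚ.toℚᵘ-injective (begin
  toℚᵘ (+ suc n / 1)                 ≈⟨ ℚ.toℚᵘ-fromℚᵘ (mkℚᵘ (+ suc n) 0) ⟩
  mkℚᵘ (+ suc n) 0                   ≡⟨ ℚᵘ./-cong (cong (ℤ._+_ (+ 1)) (ℤ.*-identityʳ (+ n))) refl ⟨
  ℚᵘ.1ℚᵘ ℚᵘ.+ mkℚᵘ (+ n) 0           ≈⟨ ℚᵘ.+-congʳ ℚᵘ.1ℚᵘ (ℚ.toℚᵘ-fromℚᵘ (mkℚᵘ (+ n) 0)) ⟨
  toℚᵘ 1ℚ ℚᵘ.+ toℚᵘ (+ n / 1)        ≈⟨ ℚ.toℚᵘ-homo-+ 1ℚ (+ n / 1) ⟨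
  toℚᵘ (1ℚ + + n / 1)                ∎)
  where open ℚᵘ.≃-Reasoning

/1-*-/ : ∀ h .{{_ : NonZero h}} i → (+ h / 1) * (i / h) ≡ i / 1
/1-*-/ h@(suc m) i = ℚ.toℚᵘ-injective (begin
  toℚᵘ (+ h / 1 * (i / h))           ≈⟨ ℚ.toℚᵘ-homo-* (+ h / 1) (i / h) ⟩
  toℚᵘ (+ h / 1) ℚᵘ.* toℚᵘ (i / h)   ≈⟨ ℚᵘ.*-cong (ℚ.toℚᵘ-fromℚᵘ (mkℚᵘ (+ h) 0))
                                                  (ℚ.toℚᵘ-fromℚᵘ (mkℚᵘ i m)) ⟩
  mkℚᵘ (+ h) 0 ℚᵘ.* mkℚᵘ i m         ≡⟨ ℚᵘ./-cong refl (ℕ.*-comm 1 h) ⟩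
  (+ h ℤ.* i) ℚᵘ./ (h ℕ.* 1)         ≈⟨ ℚᵘ.*-cancelˡ-/ h ⟩
  mkℚᵘ i 0                           ≈⟨ ℚ.toℚᵘ-fromℚᵘ (mkℚᵘ i 0) ⟨
  toℚᵘ (i / 1)                       ∎)
  where open ℚᵘ.≃-Reasoning

×1ℚ≡/1 : ∀ n → n × 1ℚ ≡ + n / 1
×1ℚ≡/1 zero    = refl
×1ℚ≡/1 (suc n) = trans (cong (_+_ 1ℚ) (×1ℚ≡/1 n)) (sym (/1-suc n))

×≡×1ℚ* : ∀ n x → n × x ≡ (n × 1ℚ) * x
×≡×1ℚ* n x = trans (cong (n ×_) (sym (ℚ.*-identityˡ x))) (sym (×-assoc-* n 1ℚ x))

×[1-2/h]*+2≡× : ∀ h .{{_ : NonZero h}} C → h × ((1ℚ - + 2 / h) * C) + (C + C) ≡ h × C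
×[1-2/h]*+2≡× h C = begin
  h × ((1ℚ - r) * C) + (C + C)
    ≡⟨ cong (_+ (C + C)) (×≡×1ℚ* h _) ⟩
  a * ((1ℚ - r) * C) + (C + C)
    ≡⟨ solve 3 (λ a r C → a :* ((con 1ℚ :- r) :* C) :+ (C :+ C)
                       := a :* C :- (a :* r) :* C :+ (C :+ C)) refl a r C ⟩
  a * C - (a * r) * C + (C + C)
    ≡⟨ cong (λ t → a * C - t * C + (C + C)) a*r≡2 ⟩
  a * C - + 2 / 1 * C + (C + C)
    ≡⟨ solve 2 (λ a C → a :* C :- con (+ 2 / 1) :* C :+ (C :+ C) := a :* C) refl a C ⟩
  a * C
    ≡⟨ ×≡×1ℚ* h C ⟨
  h × C
    ∎
  where
  open ≡-Reasoning
  open +-*-Solver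
  a r : ℚ
  a = h × 1ℚ
  r = + 2 / h
  a*r≡2 : a * r ≡ + 2 / 1
  a*r≡2 = trans (cong (_* r) (×1ℚ≡/1 h)) (/1-*-/ h (+ 2))

sumℚ-tabulate : ∀ {n} (f : Fin n → ℚ) → sumℚ (tabulate f) ≡ ∑[ i < n ] f i
sumℚ-tabulate {zero}  f = refl
sumℚ-tabulate {suc n} f = cong (_+_ (f zero)) (sumℚ-tabulate (f ∘ suc))

sumℚ-map-allFin : ∀ {n} (f : Fin n → ℚ) → sumℚ (map f (allFin n)) ≡ ∑[ i < n ] f i
sumℚ-map-allFin f = trans (cong sumℚ (map-tabulate id f)) (sumℚ-tabulate f)

∑-mono-≤ : ∀ {n} {f g : Fin n → ℚ} → (∀ i → f i ≤ g i) → ∑[ i < n ] f i ≤ ∑[ i < n ] g i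
∑-mono-≤ {zero}  f≤g = ℚ.≤-refl
∑-mono-≤ {suc n} f≤g = ℚ.+-mono-≤ (f≤g zero) (∑-mono-≤ (f≤g ∘ suc))

∀<⇒∑<× : ∀ {n} .{{_ : NonZero n}} {f : Fin n → ℚ} {x} → (∀ i → f i ℚ.< x) → ∑[ i < n ] f i ℚ.< n × x
∀<⇒∑<× {suc n} f<x =
  ℚ.+-mono-<-≤ (f<x zero) (subst (_ ≤_) (sum-replicate n) (∑-mono-≤ (ℚ.<⇒≤ ∘ f<x ∘ suc)))

∑≥×⇒∃≥ : ∀ {n} .{{_ : NonZero n}} (f : Fin n → ℚ) x → n × x ≤ ∑[ i < n ] f i → ∃ λ i → x ≤ f i
∑≥×⇒∃≥ f x n×x≤∑f with any? (λ i → x ℚ.≤? f i)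
... | yes found = found
... | no  none  =
  ⊥-elim (ℚ.<-irrefl refl (ℚ.≤-<-trans n×x≤∑f (∀<⇒∑<× (λ i → ℚ.≰⇒> (none ∘ (i ,_))))))

∑-indicator : ∀ {n} (j : Fin n) x → ∑[ i < n ] (if ⌊ j ≟ i ⌋ then x else 0ℚ) ≡ x
∑-indicator {suc n} zero    x = trans (cong (_+_ x) (sum-replicate-zero n)) (ℚ.+-identityʳ x)
∑-indicator {suc n} (suc j) x = begin
  0ℚ + ∑[ i < n ] (if ⌊ suc j ≟ suc i ⌋ then x else 0ℚ) ≡⟨ ℚ.+-identityˡ _ ⟩
  ∑[ i < n ] (if ⌊ suc j ≟ suc i ⌋ then x else 0ℚ)
    ≡⟨ sum-cong-≗ (λ i → cong (λ b → if b then x else 0ℚ) (⌊⌋-map′ _ _ (j ≟ i))) ⟩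
  ∑[ i < n ] (if ⌊ j ≟ i ⌋ then x else 0ℚ)              ≡⟨ ∑-indicator j x ⟩
  x                                                     ∎
  where open ≡-Reasoning

×-distrib-∑ : ∀ h {m} (f : Fin m → ℚ) → h × ∑[ k < m ] f k ≡ ∑[ k < m ] (h × f k)
×-distrib-∑ h {m} f = begin
  h × ∑[ k < m ] f k         ≡⟨ sum-replicate h ⟨
  ∑[ i < h ] ∑[ k < m ] f k  ≡⟨ ∑-comm (λ (_ : Fin h) → f) ⟩
  ∑[ k < m ] ∑[ i < h ] f k  ≡⟨ sum-cong-≗ (λ k → sum-replicate h {f k}) ⟩
  ∑[ k < m ] (h × f k)       ∎
  where open ≡-Reasoning

∑-lossBound : ∀ {h m} {a : Fin m → ℚ} {b : Fin h → Fin m → ℚ} →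
  (∀ k → h × a k ≤ ∑[ i < h ] b i k + (a k + a k)) →
  h × ∑[ k < m ] a k ≤ ∑[ i < h ] ∑[ k < m ] b i k + (∑[ k < m ] a k + ∑[ k < m ] a k)
∑-lossBound {h} {m} {a} {b} bound = begin
  h × ∑[ k < m ] a k
    ≡⟨ ×-distrib-∑ h a ⟩
  ∑[ k < m ] (h × a k)
    ≤⟨ ∑-mono-≤ bound ⟩
  ∑[ k < m ] (∑[ i < h ] b i k + (a k + a k))
    ≡⟨ ∑-distrib-+ (λ k → ∑[ i < h ] b i k) (λ k → a k + a k) ⟩
  ∑[ k < m ] ∑[ i < h ] b i k + ∑[ k < m ] (a k + a k)
    ≡⟨ cong₂ _+_ (∑-comm (λ k i → b i k)) (∑-distrib-+ a a) ⟩
  ∑[ i < h ] ∑[ k < m ] b i k + (∑[ k < m ] a k + ∑[ k < m ] a k)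
    ∎
  where open ℚ.≤-Reasoning

crossing : ∀ {n} → (Fin n → Fin n → ℚ) → Subset n → Fin n → Fin n → ℚ
crossing c S u v = if ⌊ u <? v ⌋ ∧ (S u xor S v) then c u v else 0ℚ

cutCost≡∑∑crossing : ∀ {n} (c : Fin n → Fin n → ℚ) S →
  cutCost c S ≡ ∑[ u < n ] ∑[ v < n ] crossing c S u v
cutCost≡∑∑crossing c S =
  trans (sumℚ-map-allFin (λ u → sumℚ (map (crossing c S u) (allFin _))))
        (sum-cong-≗ (λ u → sumℚ-map-allFin (crossing c S u)))

crossing-cong : ∀ {n} (c : Fin n → Fin n → ℚ) {S S′ : Subset n} {u v} →
  S u ≡ S′ u → S v ≡ S′ v → crossing c S u v ≡ crossing c S′ u v
crossing-cong c {u = u} {v} =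
  cong₂ (λ su sv → if ⌊ u <? v ⌋ ∧ (su xor sv) then c u v else 0ℚ)

∖-outside : ∀ {n} (S T : Subset n) {w} → T w ≡ false → (S ∖ T) w ≡ S w
∖-outside S T {w} Tw≡false = trans (cong (λ t → S w ∧ not t) Tw≡false) (∧-identityʳ (S w))

module _ {n} {c : Fin n → Fin n → ℚ} (c≥0 : ∀ (u v : Fin n) → u < v → 0ℚ ≤ c u v) where

  crossing-nonneg : ∀ S u v → 0ℚ ≤ crossing c S u v
  crossing-nonneg S u v with u <? v | S u xor S v
  ... | yes u<v | true  = c≥0 u v u<v
  ... | yes _   | false = ℚ.≤-refl
  ... | no  _   | _     = ℚ.≤-refl

  crossing-∖-≤ : ∀ S T u v → let x = crossing c S u v in
    x ≤ crossing c (S ∖ T) u v + ((if T u then x else 0ℚ) + (if T v then x else 0ℚ))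
  crossing-∖-≤ S T u v =
    x≤y+ifx+ifx (T u) (T v) (crossing-nonneg S u v) (crossing-nonneg (S ∖ T) u v)
      (λ Tu≡false Tv≡false → crossing-cong c (∖-outside S T Tu≡false) (∖-outside S T Tv≡false))

  crossing-lossBound : ∀ {h} (part : Fin n → Fin h) S u v → let x = crossing c S u v in
    h × x ≤ ∑[ i < h ] crossing c (S ∖ block part i) u v + (x + x)
  crossing-lossBound {h} part S u v = begin
    h × x
      ≡⟨ sum-replicate h ⟨
    ∑[ i < h ] x
      ≤⟨ ∑-mono-≤ (λ i → crossing-∖-≤ S (block part i) u v) ⟩
    ∑[ i < h ] (y i + (1[ part u ≡ i ] + 1[ part v ≡ i ]))
      ≡⟨ ∑-distrib-+ y (λ i → 1[ part u ≡ i ] + 1[ part v ≡ i ]) ⟩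
    ∑[ i < h ] y i + ∑[ i < h ] (1[ part u ≡ i ] + 1[ part v ≡ i ])
      ≡⟨ cong (_+_ (∑[ i < h ] y i)) (∑-distrib-+ (1[ part u ≡_]) (1[ part v ≡_])) ⟩
    ∑[ i < h ] y i + (∑[ i < h ] 1[ part u ≡ i ] + ∑[ i < h ] 1[ part v ≡ i ])
      ≡⟨ cong (_+_ (∑[ i < h ] y i)) (cong₂ _+_ (∑-indicator (part u) x) (∑-indicator (part v) x)) ⟩
    ∑[ i < h ] y i + (x + x)
      ∎
    where
    open ℚ.≤-Reasoning
    x : ℚ
    x = crossing c S u v
    y : Fin h → ℚ
    y i = crossing c (S ∖ block part i) u v
    1[_≡_] : Fin h → Fin h → ℚ
    1[ j ≡ i ] = if ⌊ j ≟ i ⌋ then x else 0ℚ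

  cutCost-lossBound : ∀ {h} (part : Fin n → Fin h) S → let C = cutCost c S in
    h × C ≤ ∑[ i < h ] cutCost c (S ∖ block part i) + (C + C)
  cutCost-lossBound {h} part S =
    subst₂ (λ C F → h × C ≤ F + (C + C))
      (sym (cutCost≡∑∑crossing c S))
      (sum-cong-≗ (λ i → sym (cutCost≡∑∑crossing c (S ∖ block part i))))
      (∑-lossBound {a = λ u → ∑[ v < n ] x u v} {b = λ i u → ∑[ v < n ] y i u v}
        (λ u → ∑-lossBound {a = x u} {b = λ i → y i u} (crossing-lossBound part S u)))
    where
    x : Fin n → Fin n → ℚ
    x = crossing c S
    y : Fin h → Fin n → Fin n → ℚ
    y i = crossing c (S ∖ block part i)

claim6 : (n h : ℕ) → .{{_ : NonZero h}}
    → (c : Fin n → Fin n → ℚ)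
    → (∀ (u v : Fin n) → u < v → 0ℚ ≤ c u v)
    → (part : Fin n → Fin h)
    → (∀ (i : Fin h) → ∃ λ (v : Fin n) → part v ≡ i)
    → (S′ : Subset n)
    → ∃ λ (i : Fin h) →
    (1ℚ - (+ 2) / h) * cutCost c S′ ≤ cutCost c (S′ ∖ block part i)
claim6 n h c c≥0 part _ S′ =
  ∑≥×⇒∃≥ F ((1ℚ - + 2 / h) * C)
    (+-cancelʳ-≤ (C + C) (subst (_≤ ∑[ i < h ] F i + (C + C)) (sym (×[1-2/h]*+2≡× h C))
      (cutCost-lossBound c≥0 part S′)))
  where
  C : ℚ
  C = cutCost c S′
  F : Fin h → ℚ
  F i = cutCost c (S′ ∖ block part i)
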